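{- If $G$ is a graph on $n$ vertices with ${\rm diam}(G)=2$, then $\Gamma_{\rho}(G)=n-i(G)+1$.
   Context: Graphs are finite and simple; $d(u,v)$ is the distance in $G$. $i(G)$ is the minimum cardinality of a maximal independent set of $G$. A packing coloring $c:V(G)\to\{1,\dots,k\}$ satisfies: $c(u)=c(v)=i$, $u\ne v$, implies $d(u,v)>i$. The Grundy packing chromatic number $\Gamma_{\rho}(G)$ is the maximum number of colors $k$ in a packing coloring $c:V(G)\to\{1,\dots,k\}$ using all $k$ colors in which every vertex $v$ with $c(v)=i$ has, for every $j\in\{1,\dots,i-1\}$, a vertex $u$ with $c(u)=j$ and $d(u,v)\le j$ (equivalently, the maximum number of colors produced by the greedy procedure that processes vertices in some order and assigns each vertex the smallest color $i$ with no already-colored vertex of color $i$ at distance at most $i$). -}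

module Defs where

open import Data.Nat using (ℕ; zero; suc; _≤_; _<_)
open import Data.Fin using (Fin)
open import Data.Fin.Subset using (Subset; _∈_; _∉_; _∪_; ⁅_⁆; ∣_∣)
open import Data.Bool using (Bool; true; false)
open import Data.Product using (Σ; ∃; _×_; _,_)
open import Relation.Binary.PropositionalEquality using (_≡_; _≢_)
open import Relation.Nullary using (¬_)

record Graph (n : ℕ) : Set where
  field
    adj   : Fin n → Fin n → Bool
    sym   : ∀ u v → adj u v ≡ adj v u
    irrefl : ∀ v → adj v v ≡ false
open Graph public

data Walk {n : ℕ} (G : Graph n) : Fin n → Fin n → ℕ → Set where
  here : ∀ {u} → Walk G u u zero
  step : ∀ {u w v k} → adj G u w ≡ true → Walk G w v k → Walk G u v (suc k)

DistLe : ∀ {n} → Graph n → Fin n → Fin n → ℕ → Set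
DistLe G u v k = Σ ℕ λ m → m ≤ k × Walk G u v m

Diam2 : ∀ {n} → Graph n → Set
Diam2 {n} G = (∀ (u v : Fin n) → DistLe G u v 2)
            × Σ (Fin n) λ u → Σ (Fin n) λ v → ¬ DistLe G u v 1

Independent : ∀ {n} → Graph n → Subset n → Set
Independent {n} G S = ∀ (u v : Fin n) → u ∈ S → v ∈ S → adj G u v ≡ false

MaximalIndependent : ∀ {n} → Graph n → Subset n → Set
MaximalIndependent {n} G S =
  Independent G S × (∀ (v : Fin n) → v ∉ S → ¬ Independent G (⁅ v ⁆ ∪ S))

IsIndepDomNumber : ∀ {n} → Graph n → ℕ → Set
IsIndepDomNumber {n} G m =
  (Σ (Subset n) λ S → MaximalIndependent G S × ∣ S ∣ ≡ m)
  × (∀ (S : Subset n) → MaximalIndependent G S → m ≤ ∣ S ∣)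

GrundyPackingColoring : ∀ {n} → Graph n → ℕ → (Fin n → ℕ) → Set
GrundyPackingColoring {n} G k c =
  (∀ (v : Fin n) → 1 ≤ c v × c v ≤ k)
  × (∀ (i : ℕ) → 1 ≤ i → i ≤ k → Σ (Fin n) λ v → c v ≡ i)
  × (∀ (u v : Fin n) → u ≢ v → c u ≡ c v → ¬ DistLe G u v (c u))
  × (∀ (v : Fin n) (j : ℕ) → 1 ≤ j → j < c v →
       Σ (Fin n) λ u → c u ≡ j × DistLe G u v j)

IsGrundyPackingNumber : ∀ {n} → Graph n → ℕ → Set
IsGrundyPackingNumber {n} G k =
  (Σ (Fin n → ℕ) λ c → GrundyPackingColoring G k c)
  × (∀ (k' : ℕ) (c : Fin n → ℕ) → GrundyPackingColoring G k' c → k' ≤ k)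

-- Colour class 1 of a Grundy packing colouring is a maximal independent set S,
-- and every other colour needs a vertex of its own outside S, so at most
-- n - |S| + 1 ≤ n - i(G) + 1 colours occur; this holds in every graph.
-- Conversely, when diam(G) = 2, give a smallest maximal independent set the
-- colour 1 and every remaining vertex its own colour 2, 3, …: a vertex outside S
-- sees colour 1 in a neighbour, by maximality, and every larger colour within
-- distance 2, by the diameter.
module Submission where

open import Defs
open import Data.Nat using (ℕ; zero; suc; _+_; _∸_; _≤_; _<_; z≤n; s≤s; _≟_)
open import Data.Nat.Properties using (≤-trans; <⇒≤; +-comm; ∸-monoʳ-≤; suc-injective)
open import Data.Fin using (Fin; toℕ; fromℕ<)
open import Data.Fin.Properties using (any?; toℕ<n; toℕ-fromℕ<; toℕ-injective; injective⇒≤)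
open import Data.Fin.Subset using (Subset; inside; outside; _∈_; _∉_; _∪_; ⁅_⁆; ∁; ∣_∣; Nonempty)
open import Data.Fin.Subset.Properties
  using (_∈?_; x∈⁅x⁆; x∈⁅y⁆⇒x≡y; x∈p∪q⁻; x∈p∪q⁺; x∈∁p⇒x∉p; x∉p⇒x∈∁p; ∣∁p∣≡n∸∣p∣)
open import Data.Bool using (true; false)
open import Data.Bool.Properties using (¬-not) renaming (_≟_ to _≟ᵇ_)
open import Data.Vec using (_∷_; here; there; tabulate)
open import Data.Vec.Properties using (lookup∘tabulate; lookup⇒[]=; []=⇒lookup)
open import Data.Product using (∃; _×_; _,_; proj₁; proj₂)
open import Data.Sum using (_⊎_; inj₁; inj₂)
open import Function.Definitions using (Injective)
open import Relation.Nullary using (¬_; yes; no; does; contradiction)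
open import Relation.Nullary.Decidable using (dec-true; _×-dec_)
open import Relation.Unary using (Pred; Decidable)
open import Relation.Binary.PropositionalEquality as ≡ using (_≡_; _≢_; refl; cong; subst)
open ≡.≡-Reasoning

private
  variable
    n : ℕ

module _ {ℓ} {P : Pred (Fin n) ℓ} (P? : Decidable P) where

  fromDec : Subset n
  fromDec = tabulate (λ x → does (P? x))

  ∈-fromDec⁺ : ∀ {x} → P x → x ∈ fromDec
  ∈-fromDec⁺ {x} px = lookup⇒[]= x fromDec (≡.trans (lookup∘tabulate _ x) (dec-true (P? x) px))

  ∈-fromDec⁻ : ∀ {x} → x ∈ fromDec → P x
  ∈-fromDec⁻ {x} x∈ with P? x | ≡.trans (≡.sym (lookup∘tabulate _ x)) ([]=⇒lookup x∈)
  ... | yes px | _ = px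
  ... | no _   | ()

∈-⁅⁆∪⁻ : ∀ {x y} {p : Subset n} → x ∈ ⁅ y ⁆ ∪ p → x ≡ y ⊎ x ∈ p
∈-⁅⁆∪⁻ {y = y} {p} x∈ with x∈p∪q⁻ ⁅ y ⁆ p x∈
... | inj₁ x∈⁅y⁆ = inj₁ (x∈⁅y⁆⇒x≡y y x∈⁅y⁆)
... | inj₂ x∈p   = inj₂ x∈p

rank : Subset n → Fin n → ℕ
rank (_       ∷ p) Fin.zero    = 0
rank (outside ∷ p) (Fin.suc x) = rank p x
rank (inside  ∷ p) (Fin.suc x) = suc (rank p x)

rank<∣p∣ : ∀ {p : Subset n} {x} → x ∈ p → rank p x < ∣ p ∣
rank<∣p∣ {p = inside  ∷ p} here       = s≤s z≤n
rank<∣p∣ {p = outside ∷ p} (there x∈) = rank<∣p∣ x∈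
rank<∣p∣ {p = inside  ∷ p} (there x∈) = s≤s (rank<∣p∣ x∈)

rank-injective : ∀ {p : Subset n} {x y} → x ∈ p → y ∈ p → rank p x ≡ rank p y → x ≡ y
rank-injective here here _ = refl
rank-injective {p = inside  ∷ p} here       (there _)  ()
rank-injective {p = inside  ∷ p} (there _)  here       ()
rank-injective {p = outside ∷ p} (there x∈) (there y∈) eq = cong Fin.suc (rank-injective x∈ y∈ eq)
rank-injective {p = inside  ∷ p} (there x∈) (there y∈) eq =
  cong Fin.suc (rank-injective x∈ y∈ (suc-injective eq))

rank-surjective : ∀ (p : Subset n) {i} → i < ∣ p ∣ → ∃ λ x → x ∈ p × rank p x ≡ i
rank-surjective (outside ∷ p) i<∣p∣ with rank-surjective p i<∣p∣
... | x , x∈p , eq = Fin.suc x , there x∈p , eq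
rank-surjective (inside ∷ p) {zero} _ = Fin.zero , here , refl
rank-surjective (inside ∷ p) {suc i} (s≤s i<∣p∣) with rank-surjective p i<∣p∣
... | x , x∈p , eq = Fin.suc x , there x∈p , cong suc eq

injective⇒≤∣p∣ : ∀ {m} {p : Subset n} {f : Fin m → Fin n} →
                 Injective _≡_ _≡_ f → (∀ i → f i ∈ p) → m ≤ ∣ p ∣
injective⇒≤∣p∣ {p = p} {f} f-injective f∈p = injective⇒≤ index-injective
  where
  index : Fin _ → Fin ∣ p ∣
  index i = fromℕ< (rank<∣p∣ (f∈p i))

  toℕ-index : ∀ i → toℕ (index i) ≡ rank p (f i)
  toℕ-index i = toℕ-fromℕ< (rank<∣p∣ (f∈p i))

  index-injective : Injective _≡_ _≡_ index
  index-injective {i} {j} eq = f-injective (rank-injective (f∈p i) (f∈p j) (begin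
    rank p (f i)     ≡⟨ toℕ-index i ⟨
    toℕ (index i)    ≡⟨ cong toℕ eq ⟩
    toℕ (index j)    ≡⟨ toℕ-index j ⟩
    rank p (f j)     ∎))

module _ (G : Graph n) where

  adj⇒≢ : ∀ {u v} → adj G u v ≡ true → u ≢ v
  adj⇒≢ {u} uv refl with ≡.trans (≡.sym uv) (irrefl G u)
  ... | ()

  adj⇒DistLe1 : ∀ {u v} → adj G u v ≡ true → DistLe G u v 1
  adj⇒DistLe1 uv = 1 , s≤s z≤n , step uv here

  DistLe1⇒≡⊎adj : ∀ {u v} → DistLe G u v 1 → u ≡ v ⊎ adj G u v ≡ true
  DistLe1⇒≡⊎adj (zero , _ , here)               = inj₁ refl
  DistLe1⇒≡⊎adj (suc zero , _ , step uw here)  = inj₂ uw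
  DistLe1⇒≡⊎adj (suc (suc _) , s≤s () , _)

  DistLe-mono : ∀ {u v k l} → k ≤ l → DistLe G u v k → DistLe G u v l
  DistLe-mono k≤l (m , m≤k , walk) = m , ≤-trans m≤k k≤l , walk

  independent⇒¬DistLe1 : ∀ {S u v} → Independent G S → u ∈ S → v ∈ S → u ≢ v →
                         ¬ DistLe G u v 1
  independent⇒¬DistLe1 S-ind u∈S v∈S u≢v d with DistLe1⇒≡⊎adj d
  ... | inj₁ u≡v = u≢v u≡v
  ... | inj₂ uv with ≡.trans (≡.sym uv) (S-ind _ _ u∈S v∈S)
  ... | ()

  insert-independent : ∀ {S v} → Independent G S → (∀ u → u ∈ S → adj G u v ≡ false) →
                       Independent G (⁅ v ⁆ ∪ S)
  insert-independent {v = v} S-ind v-far x y x∈ y∈ with ∈-⁅⁆∪⁻ x∈ | ∈-⁅⁆∪⁻ y∈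
  ... | inj₁ refl | inj₁ refl = irrefl G v
  ... | inj₁ refl | inj₂ y∈S  = ≡.trans (sym G v y) (v-far y y∈S)
  ... | inj₂ x∈S  | inj₁ refl = v-far x x∈S
  ... | inj₂ x∈S  | inj₂ y∈S  = S-ind x y x∈S y∈S

  Dominating : Subset n → Set
  Dominating S = ∀ v → v ∉ S → ∃ λ u → u ∈ S × adj G u v ≡ true

  maximal⇒dominating : ∀ {S} → MaximalIndependent G S → Dominating S
  maximal⇒dominating {S} (S-ind , S-max) v v∉S
    with any? (λ u → (u ∈? S) ×-dec (adj G u v ≟ᵇ true))
  ... | yes neighbour   = neighbour
  ... | no no-neighbour =
    contradiction (insert-independent S-ind (λ u u∈S → ¬-not (λ uv → no-neighbour (u , u∈S , uv))))
                  (S-max v v∉S)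

  dominating⇒maximal : ∀ {S} → Independent G S → Dominating S → MaximalIndependent G S
  dominating⇒maximal {S} S-ind S-dom = S-ind , not-independent
    where
    not-independent : ∀ v → v ∉ S → ¬ Independent G (⁅ v ⁆ ∪ S)
    not-independent v v∉S vS-ind with S-dom v v∉S
    ... | u , u∈S , uv
      with ≡.trans (≡.sym uv) (vS-ind u v (x∈p∪q⁺ (inj₂ u∈S)) (x∈p∪q⁺ (inj₁ (x∈⁅x⁆ v))))
    ... | ()

  maximal⇒nonempty : ∀ {S} → MaximalIndependent G S → Fin n → Nonempty S
  maximal⇒nonempty {S} S-max v with v ∈? S
  ... | yes v∈S = v , v∈S
  ... | no  v∉S with maximal⇒dominating S-max v v∉S
  ... | u , u∈S , _ = u , u∈S

colorClass : (Fin n → ℕ) → ℕ → Subset n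
colorClass c i = fromDec (λ v → c v ≟ i)

∈-colorClass⁺ : ∀ (c : Fin n → ℕ) {i v} → c v ≡ i → v ∈ colorClass c i
∈-colorClass⁺ c {i} = ∈-fromDec⁺ (λ v → c v ≟ i)

∈-colorClass⁻ : ∀ (c : Fin n → ℕ) {i v} → v ∈ colorClass c i → c v ≡ i
∈-colorClass⁻ c {i} = ∈-fromDec⁻ (λ v → c v ≟ i)

module _ {G : Graph n} {k : ℕ} {c : Fin n → ℕ} where

  colorClass1-independent : GrundyPackingColoring G k c → Independent G (colorClass c 1)
  colorClass1-independent (_ , _ , packing , _) u v u∈ v∈ with adj G u v in uv
  ... | false = refl
  ... | true  = contradiction (subst (DistLe G u v) (≡.sym cu≡1) (adj⇒DistLe1 G uv))
                              (packing u v (adj⇒≢ G uv) (≡.trans cu≡1 (≡.sym cv≡1)))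
    where
    cu≡1 = ∈-colorClass⁻ c u∈
    cv≡1 = ∈-colorClass⁻ c v∈

  colorClass1-dominating : GrundyPackingColoring G k c → Dominating G (colorClass c 1)
  colorClass1-dominating (range , _ , _ , grundy) v v∉ with c v in cv | range v
  ... | suc zero    | _ = contradiction (∈-colorClass⁺ c cv) v∉
  ... | suc (suc _) | _ with grundy v 1 (s≤s z≤n) (subst (1 <_) (≡.sym cv) (s≤s (s≤s z≤n)))
  ... | u , cu≡1 , d with DistLe1⇒≡⊎adj G d
  ... | inj₁ refl = contradiction (∈-colorClass⁺ c cu≡1) v∉
  ... | inj₂ uv   = u , ∈-colorClass⁺ c cu≡1 , uv

  colorClass1-maximal : GrundyPackingColoring G k c → MaximalIndependent G (colorClass c 1)
  colorClass1-maximal c-grundy =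
    dominating⇒maximal G (colorClass1-independent c-grundy) (colorClass1-dominating c-grundy)

grundyPacking-colors≤ : ∀ {G : Graph n} {k c} → GrundyPackingColoring G k c → k ≤ 1 + (n ∸ ∣ colorClass c 1 ∣)
grundyPacking-colors≤ {k = zero} _ = z≤n
grundyPacking-colors≤ {n} {k = suc k} {c} (_ , onto , _) =
  s≤s (subst (k ≤_) (∣∁p∣≡n∸∣p∣ (colorClass c 1)) (injective⇒≤∣p∣ w-injective w∉colorClass1))
  where
  color-used : (i : Fin k) → ∃ λ v → c v ≡ 2 + toℕ i
  color-used i = onto (2 + toℕ i) (s≤s z≤n) (s≤s (toℕ<n i))

  w : Fin k → Fin n
  w i = proj₁ (color-used i)

  w-injective : Injective _≡_ _≡_ w
  w-injective {i} {j} eq = toℕ-injective (suc-injective (suc-injective (begin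
    2 + toℕ i  ≡⟨ proj₂ (color-used i) ⟨
    c (w i)    ≡⟨ cong c eq ⟩
    c (w j)    ≡⟨ proj₂ (color-used j) ⟩
    2 + toℕ j  ∎)))

  w∉colorClass1 : ∀ i → w i ∈ ∁ (colorClass c 1)
  w∉colorClass1 i = x∉p⇒x∈∁p λ w∈ → 2+m≢1 (≡.trans (≡.sym (proj₂ (color-used i))) (∈-colorClass⁻ c w∈))
    where
    2+m≢1 : ∀ {m} → 2 + m ≢ 1
    2+m≢1 ()

module Diameter≤2 {G : Graph n} (diam≤2 : ∀ u v → DistLe G u v 2)
                  {S : Subset n} (S-max : MaximalIndependent G S) (S-nonempty : Nonempty S) where

  coloring : Fin n → ℕ
  coloring v with v ∈? S
  ... | yes _ = 1
  ... | no  _ = 2 + rank (∁ S) v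

  coloring-∈ : ∀ {v} → v ∈ S → coloring v ≡ 1
  coloring-∈ {v} v∈S with v ∈? S
  ... | yes _   = refl
  ... | no  v∉S = contradiction v∈S v∉S

  coloring-∉ : ∀ {v} → v ∉ S → coloring v ≡ 2 + rank (∁ S) v
  coloring-∉ {v} v∉S with v ∈? S
  ... | yes v∈S = contradiction v∈S v∉S
  ... | no  _   = refl

  colors : ℕ
  colors = 1 + (n ∸ ∣ S ∣)

  rank<n∸∣S∣ : ∀ {v} → v ∉ S → rank (∁ S) v < n ∸ ∣ S ∣
  rank<n∸∣S∣ {v} v∉S = subst (rank (∁ S) v <_) (∣∁p∣≡n∸∣p∣ S) (rank<∣p∣ (x∉p⇒x∈∁p v∉S))

  coloring-range : ∀ v → 1 ≤ coloring v × coloring v ≤ colors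
  coloring-range v with v ∈? S
  ... | yes _   = s≤s z≤n , s≤s z≤n
  ... | no  v∉S = s≤s z≤n , s≤s (rank<n∸∣S∣ v∉S)

  coloring-onto : ∀ i → 1 ≤ i → i ≤ colors → ∃ λ v → coloring v ≡ i
  coloring-onto (suc zero) _ _ = proj₁ S-nonempty , coloring-∈ (proj₂ S-nonempty)
  coloring-onto (suc (suc i)) _ (s≤s i<)
    with rank-surjective (∁ S) (subst (i <_) (≡.sym (∣∁p∣≡n∸∣p∣ S)) i<)
  ... | v , v∈∁S , rank≡i = v , ≡.trans (coloring-∉ (x∈∁p⇒x∉p v∈∁S)) (cong (2 +_) rank≡i)

  coloring-packing : ∀ u v → u ≢ v → coloring u ≡ coloring v → ¬ DistLe G u v (coloring u)
  coloring-packing u v u≢v same with u ∈? S | v ∈? S | same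
  ... | yes u∈S | yes v∈S | _     = independent⇒¬DistLe1 G (proj₁ S-max) u∈S v∈S u≢v
  ... | no  u∉S | no  v∉S | same′ =
    contradiction (rank-injective (x∉p⇒x∈∁p u∉S) (x∉p⇒x∈∁p v∉S) (suc-injective (suc-injective same′))) u≢v

  coloring-grundy : ∀ v j → 1 ≤ j → j < coloring v → ∃ λ u → coloring u ≡ j × DistLe G u v j
  coloring-grundy v j _ _ with v ∈? S
  coloring-grundy v (suc zero) _ (s≤s ()) | yes _
  coloring-grundy v (suc zero) _ _ | no v∉S with maximal⇒dominating G S-max v v∉S
  ... | u , u∈S , uv = u , coloring-∈ u∈S , adj⇒DistLe1 G uv
  coloring-grundy v (suc (suc j)) _ j< | no v∉S
    with coloring-onto (2 + j) (s≤s z≤n) (≤-trans (<⇒≤ j<) (s≤s (rank<n∸∣S∣ v∉S)))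
  ... | u , u≡j = u , u≡j , DistLe-mono G (s≤s (s≤s z≤n)) (diam≤2 u v)

  coloring-isGrundyPacking : GrundyPackingColoring G colors coloring
  coloring-isGrundyPacking = coloring-range , coloring-onto , coloring-packing , coloring-grundy

corollary11 : (n : ℕ) (G : Graph n) → Diam2 G →
    (m : ℕ) → IsIndepDomNumber G m → IsGrundyPackingNumber G (n ∸ m + 1)
corollary11 n G (diam≤2 , (v , _)) .(∣ S ∣) ((S , S-max , refl) , minimal) =
  subst (IsGrundyPackingNumber G) (+-comm 1 (n ∸ ∣ S ∣)) (attained , bounded)
  where
  open Diameter≤2 diam≤2 S-max (maximal⇒nonempty G S-max v)

  attained : ∃ λ c → GrundyPackingColoring G colors c
  attained = coloring , coloring-isGrundyPacking

  bounded : ∀ k c → GrundyPackingColoring G k c → k ≤ colors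
  bounded k c c-grundy =
    ≤-trans (grundyPacking-colors≤ c-grundy) (s≤s (∸-monoʳ-≤ n (minimal (colorClass c 1) (colorClass1-maximal c-grundy))))
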